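{- Let $n \geq 9$. Then $\chi^{\mathcal B}_g(P_4 \square P_n) = \chi^{\mathcal B}_g(P_4 \square C_n) = 4$.
   Context: $P_m$ denotes the path on $m$ vertices and $C_n$ the cycle on $n$ vertices. For graphs $G,H$, the Cartesian product $G \square H$ has vertex set $V(G)\times V(H)$, with $(a,x)$ adjacent to $(b,y)$ iff either $a=b$ and $xy\in E(H)$, or $x=y$ and $ab\in E(G)$. In the $k$-coloring game on a graph $G$, two players alternately choose an uncolored vertex and assign it a color from $\{1,\dots,k\}$ such that the partial coloring stays proper; Alice wins if eventually all vertices are colored, and Bob wins otherwise (some uncolored vertex sees all $k$ colors among its neighbors). $\chi^{\mathcal B}_g(G)$ denotes the smallest $k$ such that Alice has a winning strategy in the $k$-coloring game on $G$ when Bob makes the first move. -}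

module Defs where

open import Data.Nat using (ℕ; zero; suc; _<_; _∸_)
open import Data.Fin using (Fin; toℕ)
open import Data.Fin.Properties using () renaming (_≟_ to _≟ᶠ_)
open import Data.Maybe using (Maybe; just; nothing)
open import Data.Product using (Σ; _×_; _,_; ∃; ∃-syntax)
open import Data.Product.Properties using (≡-dec)
open import Data.Sum using (_⊎_)
open import Relation.Nullary using (¬_; yes; no)
open import Relation.Binary.Definitions using (DecidableEquality)
open import Relation.Binary.PropositionalEquality using (_≡_; _≢_)

record Graph : Set₁ where
  field
    Vertex : Set
    _≟_    : DecidableEquality Vertex
    Adj    : Vertex → Vertex → Set
open Graph public

P : ℕ → Graph
P m = record
  { Vertex = Fin m
  ; _≟_ = _≟ᶠ_
  ; Adj = λ i j → (suc (toℕ i) ≡ toℕ j) ⊎ (suc (toℕ j) ≡ toℕ i)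
  }

C : ℕ → Graph
C n = record
  { Vertex = Fin n
  ; _≟_ = _≟ᶠ_
  ; Adj = λ i j → Succ i j ⊎ Succ j i
  }
  where
  Succ : Fin n → Fin n → Set
  Succ i j = (suc (toℕ i) ≡ toℕ j) ⊎ ((toℕ i ≡ n ∸ 1) × (toℕ j ≡ 0))

_□_ : Graph → Graph → Graph
G □ H = record
  { Vertex = Vertex G × Vertex H
  ; _≟_ = ≡-dec (_≟_ G) (_≟_ H)
  ; Adj = λ { (a , x) (b , y) → ((a ≡ b) × Adj H x y) ⊎ ((x ≡ y) × Adj G a b) }
  }

Colouring : Graph → ℕ → Set
Colouring G k = Vertex G → Maybe (Fin k)

empty : ∀ {G k} → Colouring G k
empty _ = nothing

Complete : ∀ {G k} → Colouring G k → Set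
Complete {G} c = ∀ v → ¬ (c v ≡ nothing)

LegalMove : ∀ {G k} → Colouring G k → Vertex G → Fin k → Set
LegalMove {G} c v a = (c v ≡ nothing) × (∀ w → Adj G v w → c w ≢ just a)

update : ∀ {G k} → Colouring G k → Vertex G → Fin k → Colouring G k
update {G} c v a w with _≟_ G w v
... | yes _ = just a
... | no  _ = c w

data Player : Set where
  alice bob : Player

-- The game ends when no legal move is
-- available; Alice wins iff all vertices are coloured at that point.
data AliceWins (G : Graph) (k : ℕ) : Player → Colouring G k → Set where
  done  : ∀ {p c} → Complete {G} c → AliceWins G k p c
  aliceMove : ∀ {c} (v : Vertex G) (a : Fin k) → LegalMove {G} c v a →
              AliceWins G k bob (update {G} c v a) → AliceWins G k alice c
  bobMove : ∀ {c} → (∃[ v ] ∃[ a ] LegalMove {G} c v a) →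
            (∀ v a → LegalMove {G} c v a → AliceWins G k alice (update {G} c v a)) →
            AliceWins G k bob c

AliceWinsB : Graph → ℕ → Set
AliceWinsB G k = AliceWins G k bob (empty {G} {k})

GameChromaticB≡ : Graph → ℕ → Set
GameChromaticB≡ G k = AliceWinsB G k × (∀ j → j < k → ¬ AliceWinsB G j)

-- Upper bound: Alice answers each move of Bob at (r , y) with the same colour at (r + 2 mod 4 , y).
-- The colouring then stays invariant under this shift of rows, which exchanges the two vertical
-- neighbours of every vertex; so an uncoloured vertex of P₄ □ H sees at most 1 + Δ(H) colours and
-- is never blocked when 2 + Δ(H) colours are available. Paths and cycles have Δ = 2.
--
-- Lower bound: the first five columns of P₄ □ Pₙ or P₄ □ Cₙ (n ≥ 5) form a 4 × 5 grid whose
-- three middle columns have no neighbours outside it. Bob can play inside this grid only: an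
-- outside move of Alice leaves the grid unchanged, and a vertex blocked within the grid is blocked
-- in the whole graph. For each j < 4 an explicit strategy of Bob forcing a blocked grid vertex
-- with j colours is checked by evaluation.

module Submission where

open import Defs
open import Data.Empty using (⊥)
open import Data.Nat as ℕ using (ℕ; zero; suc; _+_; _∸_; _≤_; _<_; z≤n; s≤s; _<?_)
open import Data.Nat.ListAction using (sum)
open import Data.Nat.Properties
  using (≤-refl; ≤-trans; ≤-<-trans; <-≤-trans; <-trans; <-irrefl; <⇒≢; <⇒≱; n<1+n; m≤n+m;
         +-mono-≤; +-mono-≤-<; suc-injective)
open import Data.Fin using (Fin; zero; suc; toℕ; #_; fromℕ; fromℕ<; inject₁; inject≤)
open import Data.Fin.Properties
  using (any?; all?; ¬∀⟶∃¬; injective⇒≤; toℕ-injective; toℕ<n; toℕ-fromℕ; toℕ-fromℕ<;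
         toℕ-inject₁; toℕ-inject≤; inject≤-injective)
  renaming (_≟_ to _≟ᶠ_)
open import Data.Maybe using (Maybe; just; nothing)
open import Data.Maybe.Properties using (just-injective) renaming (≡-dec to ≡-dec-Maybe)
open import Data.Product using (Σ; _×_; _,_; ∃; ∃-syntax; proj₁; proj₂)
open import Data.Sum using (_⊎_; inj₁; inj₂) renaming (map to map-⊎)
open import Data.List using (List; []; _∷_; _++_; map; cartesianProduct; allFin)
open import Data.List.Relation.Unary.Any as Any using (here; there)
open import Data.List.Relation.Unary.All as All using ()
open import Data.List.Membership.Propositional using (_∈_; find; lose)
open import Data.List.Membership.Propositional.Properties using (∈-cartesianProduct⁺; ∈-allFin)
open import Data.Vec using (Vec; lookup; replicate; _[_]≔_)
open import Data.Vec.Properties using (lookup∘update; lookup∘update′; lookup-replicate)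
open import Data.Vec.Functional using () renaming ([] to []ᶠ; _∷_ to _∷ᶠ_)
open import Function using (_∘_)
open import Relation.Nullary using (¬_; Dec; yes; no; contradiction)
open import Relation.Nullary.Decidable
  using (map′; ¬?; _×-dec_; _⊎-dec_; _→-dec_; from-yes; decidable-stable)
open import Relation.Unary using (Decidable)
open import Relation.Binary.PropositionalEquality
  using (_≡_; _≢_; refl; sym; trans; cong; cong₂; subst; module ≡-Reasoning)

Enumeration : Set → Set
Enumeration A = Σ (List A) λ xs → ∀ x → x ∈ xs

Fin-enumeration : ∀ n → Enumeration (Fin n)
Fin-enumeration n = allFin n , ∈-allFin

×-enumeration : ∀ {A B} → Enumeration A → Enumeration B → Enumeration (A × B)
×-enumeration (xs , ∈-xs) (ys , ∈-ys) =
  cartesianProduct xs ys , λ (x , y) → ∈-cartesianProduct⁺ (∈-xs x) (∈-ys y)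

∃-enumerated? : ∀ {A} → Enumeration A → {P : A → Set} → Decidable P → Dec (∃ P)
∃-enumerated? (xs , ∈-xs) P? = map′ (λ any → let x , _ , px = find any in x , px)
                                    (λ (x , px) → lose (∈-xs x) px)
                                    (Any.any? P? xs)

∀-enumerated? : ∀ {A} → Enumeration A → {P : A → Set} → Decidable P → Dec (∀ x → P x)
∀-enumerated? (xs , ∈-xs) P? = map′ (λ all x → All.lookup all (∈-xs x))
                                    (λ all → All.tabulate (λ {x} _ → all x))
                                    (All.all? P? xs)

_≟ᴹ_ : ∀ {k} (x y : Maybe (Fin k)) → Dec (x ≡ y)
_≟ᴹ_ = ≡-dec-Maybe _≟ᶠ_

missing-colour : ∀ {m k} → m < k → (f : Fin m → Maybe (Fin k)) → ∃[ a ] (∀ i → f i ≢ just a)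
missing-colour {m} {k} m<k f with any? (λ a → all? (λ i → ¬? (f i ≟ᴹ just a)))
... | yes free = free
... | no none = contradiction (injective⇒≤ position-injective) (<⇒≱ m<k)
  where
  occurrence : ∀ a → ∃[ i ] ¬ ¬ f i ≡ just a
  occurrence a = ¬∀⟶∃¬ m _ (λ i → ¬? (f i ≟ᴹ just a)) (λ free → none (a , free))

  position : Fin k → Fin m
  position a = proj₁ (occurrence a)

  occurs : ∀ a → f (position a) ≡ just a
  occurs a = decidable-stable (_ ≟ᴹ _) (proj₂ (occurrence a))

  position-injective : ∀ {a b} → position a ≡ position b → a ≡ b
  position-injective {a} {b} eq = just-injective (trans (sym (occurs a)) (trans (cong f eq) (occurs b)))

-- Game positions

module _ {G : Graph} {k : ℕ} where

  update-self : ∀ (c : Colouring G k) v a → update {G} c v a v ≡ just a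
  update-self c v a with _≟_ G v v
  ... | yes _ = refl
  ... | no v≢v = contradiction refl v≢v

  update-other : ∀ (c : Colouring G k) v a {w} → w ≢ v → update {G} c v a w ≡ c w
  update-other c v a {w} w≢v with _≟_ G w v
  ... | yes w≡v = contradiction w≡v w≢v
  ... | no _ = refl

  Blocked : Colouring G k → Vertex G → Set
  Blocked c v = (c v ≡ nothing) × (∀ a → ∃[ w ] (Adj G v w × c w ≡ just a))

  blocked-update : ∀ {c v u b} → Blocked c v → LegalMove {G} c u b → Blocked (update {G} c u b) v
  blocked-update {c} {v} {u} {b} (cv , sees) (cu , legal) = trans (update-other c u b v≢u) cv , sees′
    where
    v≢u : v ≢ u
    v≢u refl = let w , vw , cw = sees b in legal w vw cw
    coloured≢u : ∀ {w a} → c w ≡ just a → w ≢ u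
    coloured≢u cw refl = contradiction (trans (sym cu) cw) λ ()
    sees′ : ∀ a → ∃[ w ] (Adj G v w × update {G} c u b w ≡ just a)
    sees′ a = let w , vw , cw = sees a in w , vw , trans (update-other c u b (coloured≢u cw)) cw

  blocked⇒¬AliceWins : ∀ {p c v} → Blocked c v → ¬ AliceWins G k p c
  blocked⇒¬AliceWins (cv , _) (done complete) = complete _ cv
  blocked⇒¬AliceWins blocked (aliceMove u b legal rest) =
    blocked⇒¬AliceWins (blocked-update blocked legal) rest
  blocked⇒¬AliceWins blocked (bobMove (u , b , legal) next) =
    blocked⇒¬AliceWins (blocked-update blocked legal) (next u b legal)

  blank : Maybe (Fin k) → ℕ
  blank nothing = 1
  blank (just _) = 0

  uncoloured : Colouring G k → List (Vertex G) → ℕ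
  uncoloured c vs = sum (map (blank ∘ c) vs)

  blank-update : ∀ c v a w → blank (update {G} c v a w) ≤ blank (c w)
  blank-update c v a w with _≟_ G w v
  ... | yes _ = z≤n
  ... | no _ = ≤-refl

  uncoloured-update-≤ : ∀ c v a vs → uncoloured (update {G} c v a) vs ≤ uncoloured c vs
  uncoloured-update-≤ c v a [] = z≤n
  uncoloured-update-≤ c v a (w ∷ vs) = +-mono-≤ (blank-update c v a w) (uncoloured-update-≤ c v a vs)

  uncoloured-update-< : ∀ c v a {vs} → c v ≡ nothing → v ∈ vs →
                        uncoloured (update {G} c v a) vs < uncoloured c vs
  uncoloured-update-< c v a {v ∷ vs} cv (here refl) rewrite update-self c v a | cv =
    s≤s (uncoloured-update-≤ c v a vs)
  uncoloured-update-< c v a {w ∷ vs} cv (there v∈vs) =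
    +-mono-≤-< (blank-update c v a w) (uncoloured-update-< c v a cv v∈vs)

-- Paths and cycles

P-adj? : ∀ m (i j : Fin m) → Dec (Adj (P m) i j)
P-adj? m i j = (suc (toℕ i) ℕ.≟ toℕ j) ⊎-dec (suc (toℕ j) ℕ.≟ toℕ i)

□-adj? : ∀ F H → (∀ a b → Dec (Adj F a b)) → (∀ x y → Dec (Adj H x y)) →
         ∀ v w → Dec (Adj (F □ H) v w)
□-adj? F H F-adj? H-adj? (a , x) (b , y) =
  (_≟_ F a b ×-dec H-adj? x y) ⊎-dec (_≟_ H x y ×-dec F-adj? a b)

P⊆C : ∀ {n} {y y′ : Fin n} → Adj (P n) y y′ → Adj (C n) y y′
P⊆C (inj₁ y+1≡y′) = inj₁ (inj₁ y+1≡y′)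
P⊆C (inj₂ y′+1≡y) = inj₂ (inj₁ y′+1≡y)

C⊆P-inner : ∀ {n} {y y′ : Fin n} → 0 < toℕ y → suc (toℕ y) < n →
            Adj (C n) y y′ → Adj (P n) y y′
C⊆P-inner _ _ (inj₁ (inj₁ y+1≡y′)) = inj₁ y+1≡y′
C⊆P-inner {suc n} _ y+1<n (inj₁ (inj₂ (y≡n , _))) =
  contradiction (subst (λ i → suc i < suc n) y≡n y+1<n) (<-irrefl refl)
C⊆P-inner _ _ (inj₂ (inj₁ y′+1≡y)) = inj₂ y′+1≡y
C⊆P-inner 0<y _ (inj₂ (inj₂ (_ , y≡0))) = contradiction (sym y≡0) (<⇒≢ 0<y)

CycleSucc : ∀ n → Fin n → Fin n → Set
CycleSucc n i j = (suc (toℕ i) ≡ toℕ j) ⊎ ((toℕ i ≡ n ∸ 1) × (toℕ j ≡ 0))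

cycle-succ : ∀ {n} → Fin n → Fin n
cycle-succ {suc n} i with suc (toℕ i) <? suc n
... | yes i+1<n = fromℕ< i+1<n
... | no _ = zero

cycle-pred : ∀ {n} → Fin n → Fin n
cycle-pred {suc n} zero = fromℕ n
cycle-pred {suc n} (suc i) = inject₁ i

cycle-succ-unique : ∀ {n} {y y′ : Fin n} → CycleSucc n y y′ → y′ ≡ cycle-succ y
cycle-succ-unique {suc n} {y} {y′} succ with suc (toℕ y) <? suc n | succ
... | yes y+1<n | inj₁ y+1≡y′ = toℕ-injective (trans (sym y+1≡y′) (sym (toℕ-fromℕ< y+1<n)))
... | yes y+1<n | inj₂ (y≡n , _) =
  contradiction (subst (λ i → suc i < suc n) y≡n y+1<n) (<-irrefl refl)
... | no y+1≮n | inj₁ y+1≡y′ = contradiction (subst (_< suc n) (sym y+1≡y′) (toℕ<n y′)) y+1≮n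
... | no _ | inj₂ (_ , y′≡0) = toℕ-injective y′≡0

cycle-pred-unique : ∀ {n} {y y′ : Fin n} → CycleSucc n y′ y → y′ ≡ cycle-pred y
cycle-pred-unique {suc n} {zero} (inj₂ (y′≡n , _)) =
  toℕ-injective (trans y′≡n (sym (toℕ-fromℕ n)))
cycle-pred-unique {suc n} {suc i} (inj₁ y′+1≡y) =
  toℕ-injective (trans (suc-injective y′+1≡y) (sym (toℕ-inject₁ i)))

MaxDegree≤ : Graph → ℕ → Set
MaxDegree≤ H d = ∀ y → Σ (Fin d → Vertex H) λ nb →
  ∀ {y′} → Adj H y y′ → ∃[ i ] y′ ≡ nb i

C-max-degree : ∀ n → MaxDegree≤ (C n) 2
C-max-degree n y = (cycle-succ y ∷ᶠ cycle-pred y ∷ᶠ []ᶠ) , λ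
  { (inj₁ succ) → zero , cycle-succ-unique succ
  ; (inj₂ pred) → suc zero , cycle-pred-unique pred }

P-max-degree : ∀ n → MaxDegree≤ (P n) 2
P-max-degree n y = let nb , covered = C-max-degree n y in nb , covered ∘ P⊆C

-- The pairing strategy

mirror-row : Fin 4 → Fin 4
mirror-row zero = # 2
mirror-row (suc zero) = # 3
mirror-row (suc (suc zero)) = # 0
mirror-row (suc (suc (suc zero))) = # 1

mirror-row-involutive : ∀ r → mirror-row (mirror-row r) ≡ r
mirror-row-involutive zero = refl
mirror-row-involutive (suc zero) = refl
mirror-row-involutive (suc (suc zero)) = refl
mirror-row-involutive (suc (suc (suc zero))) = refl

mirror-row-≢ : ∀ r → mirror-row r ≢ r
mirror-row-≢ = from-yes (all? λ r → ¬? (mirror-row r ≟ᶠ r))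

mirror-row-nonadjacent : ∀ r → ¬ Adj (P 4) (mirror-row r) r
mirror-row-nonadjacent = from-yes (all? λ r → ¬? (P-adj? 4 (mirror-row r) r))

neighbours-of-mirror-row : ∀ r r′ → Adj (P 4) (mirror-row r) r′ →
                           Adj (P 4) r r′ ⊎ Adj (P 4) r (mirror-row r′)
neighbours-of-mirror-row = from-yes (all? λ r → all? λ r′ →
  P-adj? 4 (mirror-row r) r′ →-dec (P-adj? 4 r r′ ⊎-dec P-adj? 4 r (mirror-row r′)))

row-neighbour : Fin 4 → Fin 4
row-neighbour zero = # 1
row-neighbour (suc zero) = # 0
row-neighbour (suc (suc zero)) = # 1
row-neighbour (suc (suc (suc zero))) = # 2

row-neighbours-mirrored : ∀ r r′ → Adj (P 4) r r′ →
                          r′ ≡ row-neighbour r ⊎ r′ ≡ mirror-row (row-neighbour r)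
row-neighbours-mirrored = from-yes (all? λ r → all? λ r′ →
  P-adj? 4 r r′ →-dec ((r′ ≟ᶠ row-neighbour r) ⊎-dec (r′ ≟ᶠ mirror-row (row-neighbour r))))

module Pairing (H : Graph) (H-vertices : Enumeration (Vertex H)) {d : ℕ} (degree : MaxDegree≤ H d) where

  G : Graph
  G = P 4 □ H

  Colours : ℕ
  Colours = 2 + d

  vertices : Enumeration (Vertex G)
  vertices = ×-enumeration (Fin-enumeration 4) H-vertices

  mirror : Vertex G → Vertex G
  mirror (r , y) = mirror-row r , y

  mirror-involutive : ∀ v → mirror (mirror v) ≡ v
  mirror-involutive (r , y) = cong (_, y) (mirror-row-involutive r)

  mirror-≢ : ∀ v → mirror v ≢ v
  mirror-≢ (r , y) eq = mirror-row-≢ r (cong proj₁ eq)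

  mirror-nonadjacent : ∀ v → ¬ Adj G (mirror v) v
  mirror-nonadjacent (r , y) (inj₁ (eq , _)) = mirror-row-≢ r eq
  mirror-nonadjacent (r , y) (inj₂ (_ , adj)) = mirror-row-nonadjacent r adj

  neighbours-of-mirror : ∀ u w → Adj G (mirror u) w → Adj G u w ⊎ Adj G u (mirror w)
  neighbours-of-mirror (r , y) (r′ , y′) (inj₁ (refl , adj)) =
    inj₂ (inj₁ (sym (mirror-row-involutive r) , adj))
  neighbours-of-mirror (r , y) (r′ , y′) (inj₂ (eq , adj)) =
    map-⊎ (λ adj′ → inj₂ (eq , adj′)) (λ adj′ → inj₂ (eq , adj′))
          (neighbours-of-mirror-row r r′ adj)

  Symmetric : Colouring G Colours → Set
  Symmetric c = ∀ v → c (mirror v) ≡ c v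

  symmetric-has-move : ∀ {c v} → Symmetric c → c v ≡ nothing → ∃[ a ] LegalMove {G} c v a
  symmetric-has-move {c} {r , y} symmetric cv = a , cv , legal
    where
    nb = proj₁ (degree y)

    forbidden : Fin (suc d) → Maybe (Fin Colours)
    forbidden = c (row-neighbour r , y) ∷ᶠ λ i → c (r , nb i)

    a = proj₁ (missing-colour ≤-refl forbidden)
    avoids = proj₂ (missing-colour ≤-refl forbidden)

    legal : ∀ w → Adj G (r , y) w → c w ≢ just a
    legal (r′ , y′) (inj₁ (refl , adj)) with proj₂ (degree y) adj
    ... | i , refl = avoids (suc i)
    legal (r′ , y′) (inj₂ (refl , adj)) with row-neighbours-mirrored r r′ adj
    ... | inj₁ refl = avoids zero
    ... | inj₂ refl = avoids zero ∘ trans (sym (symmetric (row-neighbour r , y)))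

  mirror-move-legal : ∀ {c u b} → Symmetric c → LegalMove {G} c u b →
                      LegalMove {G} (update {G} c u b) (mirror u) b
  mirror-move-legal {c} {u} {b} symmetric (cu , legal) =
    trans (update-other {G} c u b (mirror-≢ u)) (trans (symmetric u) cu) , legal′
    where
    legal′ : ∀ w → Adj G (mirror u) w → update {G} c u b w ≢ just b
    legal′ w adj updated = not-b (trans (sym (update-other {G} c u b w≢u)) updated)
      where
      w≢u : w ≢ u
      w≢u refl = mirror-nonadjacent u adj
      not-b : c w ≢ just b
      not-b with neighbours-of-mirror u w adj
      ... | inj₁ adj′ = legal w adj′
      ... | inj₂ adj′ = legal (mirror w) adj′ ∘ trans (symmetric w)

  paired-update : Colouring G Colours → Vertex G → Fin Colours → Colouring G Colours
  paired-update c u b = update {G} (update {G} c u b) (mirror u) b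

  paired-update-orbit : ∀ c u b {w} → w ≡ u ⊎ w ≡ mirror u → paired-update c u b w ≡ just b
  paired-update-orbit c u b (inj₁ refl) =
    trans (update-other {G} (update {G} c u b) (mirror u) b (mirror-≢ u ∘ sym)) (update-self {G} c u b)
  paired-update-orbit c u b (inj₂ refl) = update-self {G} (update {G} c u b) (mirror u) b

  paired-update-other : ∀ c u b {w} → w ≢ u → w ≢ mirror u → paired-update c u b w ≡ c w
  paired-update-other c u b w≢u w≢u′ =
    trans (update-other {G} (update {G} c u b) (mirror u) b w≢u′) (update-other {G} c u b w≢u)

  paired-update-symmetric : ∀ {c} u b → Symmetric c → Symmetric (paired-update c u b)
  paired-update-symmetric {c} u b symmetric v = by-cases (_≟_ G v u) (_≟_ G v (mirror u))
    where
    open ≡-Reasoning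
    orbit = paired-update-orbit c u b
    by-cases : Dec (v ≡ u) → Dec (v ≡ mirror u) →
               paired-update c u b (mirror v) ≡ paired-update c u b v
    by-cases (yes refl) _ = trans (orbit (inj₂ refl)) (sym (orbit (inj₁ refl)))
    by-cases (no _) (yes refl) = trans (orbit (inj₁ (mirror-involutive u))) (sym (orbit (inj₂ refl)))
    by-cases (no v≢u) (no v≢u′) = begin
      paired-update c u b (mirror v)  ≡⟨ paired-update-other c u b mv≢u mv≢u′ ⟩
      c (mirror v)                    ≡⟨ symmetric v ⟩
      c v                             ≡⟨ sym (paired-update-other c u b v≢u v≢u′) ⟩
      paired-update c u b v           ∎
      where
      mv≢u : mirror v ≢ u
      mv≢u eq = v≢u′ (trans (sym (mirror-involutive v)) (cong mirror eq))
      mv≢u′ : mirror v ≢ mirror u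
      mv≢u′ eq = v≢u (trans (sym (mirror-involutive v)) (trans (cong mirror eq) (mirror-involutive u)))

  alice-wins-from : ∀ m c → Symmetric c → uncoloured {G} c (proj₁ vertices) < m →
                    AliceWins G Colours bob c
  alice-wins-from (suc m) c symmetric (s≤s bound)
    with ∃-enumerated? vertices (λ v → c v ≟ᴹ nothing)
  ... | no none = done λ v cv → none (v , cv)
  ... | yes (v , cv) = bobMove (v , symmetric-has-move symmetric cv) λ u b legal →
    aliceMove (mirror u) b (mirror-move-legal symmetric legal)
      (alice-wins-from m (paired-update c u b) (paired-update-symmetric u b symmetric)
        (≤-<-trans (uncoloured-update-≤ {G} (update {G} c u b) (mirror u) b (proj₁ vertices))
          (<-≤-trans (uncoloured-update-< {G} c u b (proj₁ legal) (proj₂ vertices u)) bound)))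

  alice-wins : AliceWinsB G Colours
  alice-wins = alice-wins-from _ (empty {G}) (λ _ → refl) ≤-refl

-- Windows

record Window (W G : Graph) (Interior : Vertex W → Set) : Set where
  field
    embed : Vertex W → Vertex G
    embed-injective : ∀ {v w} → embed v ≡ embed w → v ≡ w
    embed-adjacent : ∀ {v w} → Adj W v w → Adj G (embed v) (embed w)
    interior-closed : ∀ {v u} → Interior v → Adj G (embed v) u → ∃[ w ] (Adj W v w × u ≡ embed w)

□-window : ∀ {W H I} (F : Graph) → Window W H I → Window (F □ W) (F □ H) (I ∘ proj₂)
□-window {W} {H} {I} F window = record
  { embed = λ (a , x) → a , embed x
  ; embed-injective = λ eq → cong₂ _,_ (cong proj₁ eq) (embed-injective (cong proj₂ eq))
  ; embed-adjacent = λ { (inj₁ (refl , adj)) → inj₁ (refl , embed-adjacent adj)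
                       ; (inj₂ (refl , adj)) → inj₂ (refl , adj) }
  ; interior-closed = closed
  }
  where
  open Window window
  closed : ∀ {v u} → I (proj₂ v) → Adj (F □ H) (proj₁ v , embed (proj₂ v)) u →
           ∃[ w ] (Adj (F □ W) v w × u ≡ (proj₁ w , embed (proj₂ w)))
  closed {a , x} {b , y} inner (inj₁ (refl , adj)) with interior-closed inner adj
  ... | w , adj′ , refl = (a , w) , inj₁ (refl , adj′) , refl
  closed {a , x} {b , y} inner (inj₂ (refl , adj)) = (b , x) , inj₂ (refl , adj) , refl

Inner : ∀ {m} → Fin m → Set
Inner {m} t = 0 < toℕ t × suc (toℕ t) < m

inner? : ∀ {m} (t : Fin m) → Dec (Inner t)
inner? {m} t = (0 <? toℕ t) ×-dec (suc (toℕ t) <? m)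

P-window : ∀ {m n} → m ≤ n → Window (P m) (P n) Inner
P-window {m} {n} m≤n = record
  { embed = embed
  ; embed-injective = inject≤-injective m≤n m≤n _ _
  ; embed-adjacent = adjacent
  ; interior-closed = closed
  }
  where
  embed : Fin m → Fin n
  embed t = inject≤ t m≤n

  adjacent : ∀ {v w} → Adj (P m) v w → Adj (P n) (embed v) (embed w)
  adjacent {v} {w} adj rewrite toℕ-inject≤ v m≤n | toℕ-inject≤ w m≤n = adj

  preimage : ∀ {u : Fin n} (u<m : toℕ u < m) → u ≡ embed (fromℕ< u<m)
  preimage u<m = toℕ-injective (sym (trans (toℕ-inject≤ _ m≤n) (toℕ-fromℕ< u<m)))

  closed : ∀ {t u} → Inner t → Adj (P n) (embed t) u → ∃[ w ] (Adj (P m) t w × u ≡ embed w)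
  closed {t} {u} (_ , t+1<m) adj rewrite toℕ-inject≤ t m≤n with adj
  ... | inj₁ t+1≡u = w , inj₁ (trans t+1≡u (sym (toℕ-fromℕ< u<m))) , preimage u<m
    where
    u<m = subst (_< m) t+1≡u t+1<m
    w = fromℕ< u<m
  ... | inj₂ u+1≡t = w , inj₂ (trans (cong suc (toℕ-fromℕ< u<m)) u+1≡t) , preimage u<m
    where
    u<m = <-trans (subst (toℕ u <_) u+1≡t (n<1+n _)) (<-trans (n<1+n _) t+1<m)
    w = fromℕ< u<m

C-window : ∀ {m n} → m ≤ n → Window (P m) (C n) Inner
C-window {m} {n} m≤n = record
  { embed = embed
  ; embed-injective = embed-injective
  ; embed-adjacent = P⊆C ∘ embed-adjacent
  ; interior-closed = λ {t} inner → interior-closed inner ∘ C⊆P-inner (0<t t inner) (t+1<n t inner)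
  }
  where
  open Window (P-window m≤n)
  0<t : ∀ t → Inner t → 0 < toℕ (embed t)
  0<t t (0<t , _) rewrite toℕ-inject≤ t m≤n = 0<t
  t+1<n : ∀ t → Inner t → suc (toℕ (embed t)) < n
  t+1<n t (_ , t+1<m) rewrite toℕ-inject≤ t m≤n = <-≤-trans t+1<m m≤n

-- Bob's certificates

data Strategy (V : Set) (k : ℕ) : Set where
  blocked : V → Strategy V k
  block : V → Fin k → V → Strategy V k
  play : V → Fin k → List (Strategy V k) → Strategy V k

module Certificates {a b : ℕ} (neighbours : Fin a × Fin b → List (Fin a × Fin b))
                    (neighbours-adjacent : ∀ {v w} → w ∈ neighbours v → Adj (P a □ P b) v w)
                    (adjacent-neighbours : ∀ {v w} → Adj (P a □ P b) v w → w ∈ neighbours v)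
                    {Interior : Fin a × Fin b → Set} (interior? : Decidable Interior) where

  Grid : Graph
  Grid = P a □ P b

  Cell : Set
  Cell = Vertex Grid

  -- Local positions are tables rather than functions so that checking a certificate by
  -- evaluation stays fast.
  Table : ℕ → Set
  Table k = Vec (Vec (Maybe (Fin k)) b) a

  ⟦_⟧ : ∀ {k} → Table k → Colouring Grid k
  ⟦ T ⟧ (r , t) = lookup (lookup T r) t

  blank-table : ∀ {k} → Table k
  blank-table = replicate a (replicate b nothing)

  paint : ∀ {k} → Table k → Cell → Fin k → Table k
  paint T (r , t) x = T [ r ]≔ (lookup T r [ t ]≔ just x)

  ⟦blank-table⟧ : ∀ {k} v → ⟦ blank-table {k} ⟧ v ≡ nothing
  ⟦blank-table⟧ (r , t) =
    trans (cong (λ row → lookup row t) (lookup-replicate r _)) (lookup-replicate t nothing)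

  ⟦paint⟧-self : ∀ {k} (T : Table k) v x → ⟦ paint T v x ⟧ v ≡ just x
  ⟦paint⟧-self T (r , t) x rewrite lookup∘update r T (lookup T r [ t ]≔ just x) =
    lookup∘update t (lookup T r) (just x)

  ⟦paint⟧-other : ∀ {k} (T : Table k) v x {w} → w ≢ v → ⟦ paint T v x ⟧ w ≡ ⟦ T ⟧ w
  ⟦paint⟧-other T (r , t) x {r′ , t′} w≢v with r′ ≟ᶠ r
  ... | yes refl rewrite lookup∘update r T (lookup T r [ t ]≔ just x) =
    lookup∘update′ (λ t′≡t → w≢v (cong (r ,_) t′≡t)) (lookup T r) (just x)
  ... | no r′≢r rewrite lookup∘update′ r′≢r T (lookup T r [ t ]≔ just x) = refl

  mutual
    Wins : ∀ {k} → Table k → Strategy Cell k → Set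
    Wins T (blocked v) = Blocked {Grid} ⟦ T ⟧ v
    Wins T (block v x w) = Interior v × LegalMove {Grid} ⟦ T ⟧ v x × Blocked {Grid} ⟦ paint T v x ⟧ w
    Wins T (play v x ss) = Interior v × LegalMove {Grid} ⟦ T ⟧ v x × Answers (paint T v x) ss

    -- The first component covers the moves of Alice outside the grid, which leave the table unchanged.
    Answers : ∀ {k} → Table k → List (Strategy Cell k) → Set
    Answers T ss = WinsSome T ss × (∀ w y → LegalMove {Grid} ⟦ T ⟧ w y → WinsSome (paint T w y) ss)

    WinsSome : ∀ {k} → Table k → List (Strategy Cell k) → Set
    WinsSome T [] = ⊥
    WinsSome T (s ∷ ss) = Wins T s ⊎ WinsSome T ss

  private
    cells : Enumeration Cell
    cells = ×-enumeration (Fin-enumeration a) (Fin-enumeration b)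

  blocked? : ∀ {k} (T : Table k) v → Dec (Blocked {Grid} ⟦ T ⟧ v)
  blocked? T v = (⟦ T ⟧ v ≟ᴹ nothing) ×-dec all? λ x →
    map′ (λ any → let w , w∈ , Tw = find any in w , neighbours-adjacent w∈ , Tw)
         (λ (w , adj , Tw) → lose (adjacent-neighbours adj) Tw)
         (Any.any? (λ w → ⟦ T ⟧ w ≟ᴹ just x) (neighbours v))

  legal? : ∀ {k} (T : Table k) v x → Dec (LegalMove {Grid} ⟦ T ⟧ v x)
  legal? T v x = (⟦ T ⟧ v ≟ᴹ nothing) ×-dec
    map′ (λ all w adj → All.lookup all (adjacent-neighbours adj))
         (λ all → All.tabulate (λ w∈ → all _ (neighbours-adjacent w∈)))
         (All.all? (λ w → ¬? (⟦ T ⟧ w ≟ᴹ just x)) (neighbours v))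

  mutual
    wins? : ∀ {k} (T : Table k) s → Dec (Wins T s)
    wins? T (blocked v) = blocked? T v
    wins? T (block v x w) = interior? v ×-dec legal? T v x ×-dec blocked? (paint T v x) w
    wins? T (play v x ss) = interior? v ×-dec legal? T v x ×-dec answers? (paint T v x) ss

    answers? : ∀ {k} (T : Table k) ss → Dec (Answers T ss)
    answers? T ss = winsSome? T ss ×-dec ∀-enumerated? cells λ w → all? λ y →
      legal? T w y →-dec winsSome? (paint T w y) ss

    winsSome? : ∀ {k} (T : Table k) ss → Dec (WinsSome T ss)
    winsSome? T [] = no λ ()
    winsSome? T (s ∷ ss) = wins? T s ⊎-dec winsSome? T ss

  module Soundness {G : Graph} (window : Window Grid G Interior) {k : ℕ} where
    open Window window

    Agrees : Colouring G k → Table k → Set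
    Agrees c T = ∀ v → c (embed v) ≡ ⟦ T ⟧ v

    agrees-paint : ∀ {c} T w y → Agrees c T → Agrees (update {G} c (embed w) y) (paint T w y)
    agrees-paint {c} T w y agrees v with _≟_ Grid v w
    ... | yes refl = trans (update-self {G} c (embed v) y) (sym (⟦paint⟧-self T v y))
    ... | no v≢w = begin
      update {G} c (embed w) y (embed v) ≡⟨ update-other {G} c (embed w) y (v≢w ∘ embed-injective) ⟩
      c (embed v)                       ≡⟨ agrees v ⟩
      ⟦ T ⟧ v                           ≡⟨ sym (⟦paint⟧-other T w y v≢w) ⟩
      ⟦ paint T w y ⟧ v                 ∎
      where open ≡-Reasoning

    agrees-update-outside : ∀ {c} T {u} y → (∀ w → u ≢ embed w) → Agrees c T →
                            Agrees (update {G} c u y) T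
    agrees-update-outside {c} T {u} y outside agrees v =
      trans (update-other {G} c u y λ eq → outside v (sym eq)) (agrees v)

    legal-lift : ∀ {c} T {v x} → Interior v → LegalMove {Grid} ⟦ T ⟧ v x → Agrees c T →
                 LegalMove {G} c (embed v) x
    legal-lift {c} T {v} {x} interior (Tv , legal) agrees = trans (agrees v) Tv , legal′
      where
      legal′ : ∀ u → Adj G (embed v) u → c u ≢ just x
      legal′ u adj with interior-closed interior adj
      ... | w , adj′ , refl = legal w adj′ ∘ trans (sym (agrees w))

    legal-restrict : ∀ {c} T {w y} → LegalMove {G} c (embed w) y → Agrees c T →
                     LegalMove {Grid} ⟦ T ⟧ w y
    legal-restrict T {w} (cw , legal) agrees =
      trans (sym (agrees w)) cw , λ w′ adj → legal (embed w′) (embed-adjacent adj) ∘ trans (agrees w′)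

    blocked-lift : ∀ {c} T {v} → Blocked {Grid} ⟦ T ⟧ v → Agrees c T → Blocked {G} c (embed v)
    blocked-lift T {v} (Tv , sees) agrees = trans (agrees v) Tv , λ x →
      let w , adj , Tw = sees x in embed w , embed-adjacent adj , trans (agrees w) Tw

    wins⇒uncoloured : ∀ {T : Table k} s → Wins T s → ∃[ v ] ⟦ T ⟧ v ≡ nothing
    wins⇒uncoloured (blocked v) (Tv , _) = v , Tv
    wins⇒uncoloured (block v _ _) (_ , (Tv , _) , _) = v , Tv
    wins⇒uncoloured (play v _ _) (_ , (Tv , _) , _) = v , Tv

    winsSome⇒uncoloured : ∀ {T : Table k} ss → WinsSome T ss → ∃[ v ] ⟦ T ⟧ v ≡ nothing
    winsSome⇒uncoloured (s ∷ ss) (inj₁ wins) = wins⇒uncoloured s wins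
    winsSome⇒uncoloured (s ∷ ss) (inj₂ wins) = winsSome⇒uncoloured ss wins

    uncoloured⇒¬complete : ∀ {c} T → Agrees c T → ∃[ v ] ⟦ T ⟧ v ≡ nothing → ¬ Complete {G} c
    uncoloured⇒¬complete T agrees (v , Tv) complete = complete (embed v) (trans (agrees v) Tv)

    mutual
      wins-sound : ∀ {c} T s → Wins T s → Agrees c T → ¬ AliceWins G k bob c
      wins-sound T (blocked v) v-blocked agrees = blocked⇒¬AliceWins (blocked-lift T v-blocked agrees)
      wins-sound T s wins agrees (done complete) =
        uncoloured⇒¬complete T agrees (wins⇒uncoloured s wins) complete
      wins-sound T (block v x w) (interior , legal , w-blocked) agrees (bobMove _ next) =
        blocked⇒¬AliceWins (blocked-lift (paint T v x) w-blocked (agrees-paint T v x agrees))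
          (next (embed v) x (legal-lift T interior legal agrees))
      wins-sound T (play v x ss) (interior , legal , answers) agrees (bobMove _ next) =
        answers-sound (paint T v x) ss answers (agrees-paint T v x agrees)
          (next (embed v) x (legal-lift T interior legal agrees))

      answers-sound : ∀ {c} T ss → Answers T ss → Agrees c T → ¬ AliceWins G k alice c
      answers-sound T ss (now , _) agrees (done complete) =
        uncoloured⇒¬complete T agrees (winsSome⇒uncoloured ss now) complete
      answers-sound T ss (now , later) agrees (aliceMove u y legal rest)
        with ∃-enumerated? cells (λ w → _≟_ G u (embed w))
      ... | yes (w , refl) =
        winsSome-sound (paint T w y) ss (later w y (legal-restrict T legal agrees))
          (agrees-paint T w y agrees) rest
      ... | no outside =
        winsSome-sound T ss now (agrees-update-outside T y (λ w eq → outside (w , eq)) agrees) rest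

      winsSome-sound : ∀ {c} T ss → WinsSome T ss → Agrees c T → ¬ AliceWins G k bob c
      winsSome-sound T (s ∷ ss) (inj₁ wins) = wins-sound T s wins
      winsSome-sound T (s ∷ ss) (inj₂ wins) = winsSome-sound T ss wins

    bob-wins : ∀ s → Wins blank-table s → ¬ AliceWinsB G k
    bob-wins s wins = wins-sound blank-table s wins λ v → sym (⟦blank-table⟧ v)

path-neighbours₄ : Fin 4 → List (Fin 4)
path-neighbours₄ zero = # 1 ∷ []
path-neighbours₄ (suc zero) = # 0 ∷ # 2 ∷ []
path-neighbours₄ (suc (suc zero)) = # 1 ∷ # 3 ∷ []
path-neighbours₄ (suc (suc (suc zero))) = # 2 ∷ []

path-neighbours₅ : Fin 5 → List (Fin 5)
path-neighbours₅ zero = # 1 ∷ []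
path-neighbours₅ (suc zero) = # 0 ∷ # 2 ∷ []
path-neighbours₅ (suc (suc zero)) = # 1 ∷ # 3 ∷ []
path-neighbours₅ (suc (suc (suc zero))) = # 2 ∷ # 4 ∷ []
path-neighbours₅ (suc (suc (suc (suc zero)))) = # 3 ∷ []

grid-neighbours : Fin 4 × Fin 5 → List (Fin 4 × Fin 5)
grid-neighbours (r , t) = map (_, t) (path-neighbours₄ r) ++ map (r ,_) (path-neighbours₅ t)

private
  grid-cells : Enumeration (Fin 4 × Fin 5)
  grid-cells = ×-enumeration (Fin-enumeration 4) (Fin-enumeration 5)

  grid-adj? : ∀ v w → Dec (Adj (P 4 □ P 5) v w)
  grid-adj? = □-adj? (P 4) (P 5) (P-adj? 4) (P-adj? 5)

  _∈-grid-neighbours?_ : ∀ w v → Dec (w ∈ grid-neighbours v)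
  w ∈-grid-neighbours? v = Any.any? (_≟_ (P 4 □ P 5) w) (grid-neighbours v)

grid-neighbours-adjacent : ∀ {v w} → w ∈ grid-neighbours v → Adj (P 4 □ P 5) v w
grid-neighbours-adjacent {v} {w} =
  from-yes (∀-enumerated? grid-cells λ v → ∀-enumerated? grid-cells λ w →
              (w ∈-grid-neighbours? v) →-dec grid-adj? v w) v w

adjacent-grid-neighbours : ∀ {v w} → Adj (P 4 □ P 5) v w → w ∈ grid-neighbours v
adjacent-grid-neighbours {v} {w} =
  from-yes (∀-enumerated? grid-cells λ v → ∀-enumerated? grid-cells λ w →
              grid-adj? v w →-dec (w ∈-grid-neighbours? v)) v w

open Certificates grid-neighbours grid-neighbours-adjacent adjacent-grid-neighbours (inner? ∘ proj₂)

-- Found by a computer search; cells are (row , column). With no colours every vertex is blocked.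
strategy₀ : Strategy Cell 0
strategy₀ = blocked (# 0 , # 0)

strategy₁ : Strategy Cell 1
strategy₁ = block (# 0 , # 1) (# 0) (# 0 , # 0)

strategy₂ : Strategy Cell 2
strategy₂ =
  play (# 0 , # 1) (# 0)
    ( block (# 0 , # 3) (# 1) (# 0 , # 2)
    ∷ block (# 2 , # 1) (# 1) (# 1 , # 1)
    ∷ [])

strategy₃ : Strategy Cell 3
strategy₃ =
  play (# 1 , # 1) (# 0)
    ( play (# 2 , # 2) (# 1)
        ( block (# 0 , # 2) (# 2) (# 1 , # 2)
        ∷ block (# 3 , # 1) (# 2) (# 2 , # 1)
        ∷ [])
    ∷ play (# 2 , # 2) (# 1)
        ( block (# 3 , # 1) (# 2) (# 2 , # 1)
        ∷ block (# 1 , # 3) (# 2) (# 1 , # 2)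
        ∷ [])
    ∷ play (# 2 , # 2) (# 2)
        ( block (# 3 , # 1) (# 1) (# 2 , # 1)
        ∷ block (# 0 , # 2) (# 1) (# 1 , # 2)
        ∷ [])
    ∷ play (# 1 , # 3) (# 1)
        ( block (# 2 , # 2) (# 2) (# 1 , # 2)
        ∷ block (# 0 , # 2) (# 2) (# 1 , # 2)
        ∷ block (# 2 , # 3) (# 0) (# 2 , # 2)
        ∷ [])
    ∷ play (# 1 , # 3) (# 2)
        ( block (# 2 , # 2) (# 1) (# 1 , # 2)
        ∷ block (# 0 , # 2) (# 1) (# 1 , # 2)
        ∷ block (# 2 , # 3) (# 0) (# 2 , # 2)
        ∷ [])
    ∷ block (# 1 , # 3) (# 2) (# 1 , # 2)
    ∷ block (# 1 , # 3) (# 1) (# 1 , # 2)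
    ∷ play (# 0 , # 3) (# 0)
        ( block (# 0 , # 1) (# 2) (# 0 , # 2)
        ∷ block (# 2 , # 3) (# 2) (# 1 , # 3)
        ∷ [])
    ∷ play (# 0 , # 3) (# 0)
        ( block (# 0 , # 1) (# 1) (# 0 , # 2)
        ∷ block (# 2 , # 3) (# 1) (# 1 , # 3)
        ∷ [])
    ∷ play (# 1 , # 3) (# 1)
        ( block (# 0 , # 2) (# 2) (# 1 , # 2)
        ∷ block (# 3 , # 3) (# 2) (# 2 , # 3)
        ∷ [])
    ∷ play (# 2 , # 2) (# 1)
        ( block (# 0 , # 2) (# 2) (# 1 , # 2)
        ∷ block (# 3 , # 3) (# 2) (# 3 , # 2)
        ∷ [])
    ∷ block (# 2 , # 2) (# 2) (# 2 , # 1)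
    ∷ block (# 2 , # 2) (# 1) (# 2 , # 1)
    ∷ [])

certificate : ∀ j → j < 4 → Σ (Strategy Cell j) (Wins blank-table)
certificate 0 _ = strategy₀ , from-yes (wins? blank-table strategy₀)
certificate 1 _ = strategy₁ , from-yes (wins? blank-table strategy₁)
certificate 2 _ = strategy₂ , from-yes (wins? blank-table strategy₂)
certificate 3 _ = strategy₃ , from-yes (wins? blank-table strategy₃)
certificate (suc (suc (suc (suc _)))) (s≤s (s≤s (s≤s (s≤s ()))))

bob-wins-below-4 : ∀ {H} → Window (P 5) H Inner → ∀ j → j < 4 → ¬ AliceWinsB (P 4 □ H) j
bob-wins-below-4 window j j<4 = let s , wins = certificate j j<4 in bob-wins s wins
  where open Soundness (□-window (P 4) window)

mainTheorem3 : (n : ℕ) → 9 ≤ n →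
    GameChromaticB≡ (P 4 □ P n) 4 × GameChromaticB≡ (P 4 □ C n) 4
mainTheorem3 n 9≤n =
  (Pairing.alice-wins (P n) (Fin-enumeration n) (P-max-degree n) , bob-wins-below-4 (P-window 5≤n)) ,
  (Pairing.alice-wins (C n) (Fin-enumeration n) (C-max-degree n) , bob-wins-below-4 (C-window 5≤n))
  where
  5≤n : 5 ≤ n
  5≤n = ≤-trans (m≤n+m 5 4) 9≤n
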